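{- Let $G$ be a threshold graph on $\{0,1,\dots,n\}$ labeled by reverse degree sequence, and let $\bar d_i=\min\{d_i,i\}$. The number of increasing spanning trees of $G$ is $\prod_{i=1}^n \bar d_i$.
   Context: A threshold graph is built from one vertex by repeatedly adding a dominating vertex or an isolated vertex; labeled by reverse degree sequence means vertices $0,\dots,n$ with degrees $d_i\ge d_j$ for $i<j$. Then $\bar d_i=\min\{d_i,i\}$ equals the number of neighbors $j<i$ of $i$. Spanning trees are rooted at $0$; $v$ is a descendant of $u$ if $u$ lies on the tree path from $0$ to $v$; an inversion is a pair $(i,j)$ with $i\neq 0$, $i>j$, $j$ a descendant of $i$; a spanning tree is increasing if it has no inversions. -}

module Defs where

open import Data.Bool using (Bool; true; false; if_then_else_)
open import Data.Nat using (ℕ; zero; suc; _≤_; _⊓_)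
open import Data.Fin using (Fin; zero; suc; toℕ; _<_; _<?_)
open import Data.Fin.Properties using (_≟_; all?; any?)
open import Data.Fin.Permutation using (Permutation′; _⟨$⟩ʳ_)
open import Data.Vec using (Vec; []; _∷_; lookup)
open import Data.List using (List; []; _∷_; map; concatMap; length; filter; allFin)
open import Data.Nat.ListAction using (sum)
open import Data.Product using (Σ; ∃; _×_; _,_)
open import Relation.Nullary using (¬_; Dec)
open import Relation.Nullary.Decidable using (¬?; _×-dec_)
open import Relation.Binary.PropositionalEquality using (_≡_; _≢_)
open import Data.Nat.Base using (_<ᵇ_)

record Graph (m : ℕ) : Set where
  field
    adj    : Fin m → Fin m → Bool
    sym    : ∀ i j → adj i j ≡ adj j i
    irrefl : ∀ i → adj i i ≡ false
open Graph public

deg : ∀ {m} → Graph m → Fin m → ℕ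
deg G i = sum (map (λ j → if adj G i j then 1 else 0) (allFin _))

-- Construction: start with vertex c₀; for k = 1..n add vertex c_k, which is
-- dominating (adjacent to all c_0..c_{k-1}) if bit k is true and isolated
-- if bit k is false.  'bits' lists bits 1..n.

bitOf : ∀ {n} → Vec Bool n → Fin (suc n) → Bool
bitOf b zero    = false
bitOf b (suc k) = lookup b k

constrAdj : ∀ {n} → Vec Bool n → Fin (suc n) → Fin (suc n) → Bool
constrAdj b x y with toℕ x <ᵇ toℕ y | toℕ y <ᵇ toℕ x
... | true  | _     = bitOf b y
... | false | true  = bitOf b x
... | false | false = false

IsThreshold : ∀ {n} → Graph (suc n) → Set
IsThreshold {n} G =
  Σ (Vec Bool n) λ bits → Σ (Permutation′ (suc n)) λ σ →
    ∀ i j → adj G i j ≡ constrAdj bits (σ ⟨$⟩ʳ i) (σ ⟨$⟩ʳ j)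

ReverseDegreeLabelled : ∀ {m} → Graph m → Set
ReverseDegreeLabelled G = ∀ i j → i < j → deg G j ≤ deg G i

dbar : ∀ {m} → Graph m → Fin m → ℕ
dbar G i = deg G i ⊓ toℕ i

-- Spanning trees rooted at 0, encoded by their parent map:
-- p is a vector whose i-th entry is the parent of vertex (suc i).

ParentMap : ℕ → Set
ParentMap n = Vec (Fin (suc n)) n

parent : ∀ {n} → ParentMap n → Fin (suc n) → Fin (suc n)
parent p zero    = zero
parent p (suc i) = lookup p i

-- k-fold ancestor (the root 0 is its own "parent")
anc : ∀ {n} → ParentMap n → ℕ → Fin (suc n) → Fin (suc n)
anc p zero    v = v
anc p (suc k) v = anc p k (parent p v)

EdgesInG : ∀ {n} → Graph (suc n) → ParentMap n → Set
EdgesInG G p = ∀ (i : Fin _) → adj G (suc i) (lookup p i) ≡ true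

-- acyclic / connected: every vertex reaches the root within n steps
-- (a path to the root in a graph on n+1 vertices has at most n edges)
ReachesRoot : ∀ {n} → ParentMap n → Set
ReachesRoot {n} p = ∀ v → anc p n v ≡ zero

IsSpanningTree : ∀ {n} → Graph (suc n) → ParentMap n → Set
IsSpanningTree G p = EdgesInG G p × ReachesRoot p

Descendant : ∀ {n} → ParentMap n → Fin (suc n) → Fin (suc n) → Set
Descendant {n} p u v = ∃ λ (k : Fin (suc n)) → anc p (toℕ k) v ≡ u

Inversion : ∀ {n} → ParentMap n → Fin (suc n) → Fin (suc n) → Set
Inversion p i j = i ≢ zero × j < i × Descendant p i j

Increasing : ∀ {n} → ParentMap n → Set
Increasing p = ∀ i j → ¬ Inversion p i j

IsIncreasingSpanningTree : ∀ {n} → Graph (suc n) → ParentMap n → Set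
IsIncreasingSpanningTree G p = IsSpanningTree G p × Increasing p

private
  dec≡ : ∀ {m} (a b : Fin m) → Dec (a ≡ b)
  dec≡ = _≟_

  boolEq : (a b : Bool) → Dec (a ≡ b)
  boolEq = Data.Bool._≟_
    where import Data.Bool

isIncreasingSpanningTree? : ∀ {n} (G : Graph (suc n)) (p : ParentMap n) →
                            Dec (IsIncreasingSpanningTree G p)
isIncreasingSpanningTree? {n} G p =
  ((all? λ i → boolEq (adj G (suc i) (lookup p i)) true)
   ×-dec (all? λ v → dec≡ (anc p n v) zero))
  ×-dec (all? λ i → all? λ j →
           ¬? (¬? (dec≡ i zero) ×-dec (j <? i) ×-dec
               any? (λ k → dec≡ (anc p (toℕ k) j) i)))

allVecs : ∀ {m} (k : ℕ) → List (Vec (Fin m) k)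
allVecs zero    = [] ∷ []
allVecs (suc k) = concatMap (λ x → map (x ∷_) (allVecs k)) (allFin _)

numIncreasingSpanningTrees : ∀ {n} → Graph (suc n) → ℕ
numIncreasingSpanningTrees {n} G =
  length (filter (isIncreasingSpanningTree? G) (allVecs n))

module Submission where

-- An increasing spanning tree amounts to choosing, for every vertex i ≥ 1, a parent j < i adjacent
-- to i: parents then decrease along every path, so the parent map reaches the root and has no
-- inversions, while conversely a parent above its child would be an inversion. The number of such
-- trees is therefore the product over i of the number of neighbours of i below i.
--
-- A threshold graph has no alternating 4-cycle (edges ab, cd and non-edges ad, cb): its largest
-- vertex would have been added both as a dominating and as an isolated vertex. Hence, under the
-- reverse degree labelling, every neighbourhood is down-closed among the other vertices: if i were
-- adjacent to y but not to some x < y, then the neighbourhood of x would embed into that of y, missing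
-- i, and d_x < d_y. So the neighbours of i and the vertices below i form nested sets, and i has
-- min(d_i, i) neighbours below it.

import Data.Nat.Properties as ℕₚ
open import Algebra.Properties.Semiring.Sum ℕₚ.+-*-semiring
  using (sum-syntax; sum-cong-≗; sum-replicate-zero; ∑-permute; *-distribʳ-sum)
open import Data.Bool as Bool using (Bool; true; false; T; _∧_; if_then_else_)
open import Data.Bool.Properties using (T-≡; ∧-comm; ∧-conicalˡ; ∧-conicalʳ)
open import Data.Empty using (⊥; ⊥-elim)
open import Data.Fin using (Fin; zero; suc; toℕ; _<_; _≤_)
open import Data.Fin.Permutation using (Permutation′; _⟨$⟩ʳ_; transpose)
open import Data.Fin.Properties
  using (_≟_; _<?_; any?; toℕ≤pred[n]; toℕ-injective; <-cmp; <-trans; <⇒≢; ≤-total; ≤-trans; ≤∧≢⇒<)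
open import Data.List using (List; []; _∷_; map; allFin; concatMap; filter; length; _++_)
open import Data.List.Properties using (map-cong; map-∘; map-++; map-tabulate)
open import Data.Nat as ℕ using (ℕ; zero; suc; _+_; _*_; _∸_; _⊓_; z≤n; _<ᵇ_)
open import Data.Nat.ListAction as List using (product)
open import Data.Nat.ListAction.Properties using (sum-++)
open import Data.Nat.Properties
  using (module ≤-Reasoning; ≤-refl; ∸-+-assoc; ∸-monoˡ-≤; n≤0⇒n≡0; m≤n⇒m∸n≡0; m∸n≤m; <ᵇ⇒<; <⇒<ᵇ;
         <⇒≯; <⇒≱; ≮⇒≥; n≮n; +-mono-≤; +-mono-<-≤; +-mono-≤-<; *-identityˡ; m≤n⇒m⊓n≡m; m≥n⇒m⊓n≡n)
open import Data.Product using (_×_; _,_; proj₁; proj₂)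
open import Data.Sum using (_⊎_; inj₁; inj₂; [_,_]′)
open import Data.Vec using (Vec; []; _∷_; lookup)
open import Function using (_∘_; _⇔_; mk⇔; Equivalence; Injection)
open import Function.Properties.Equivalence using () renaming (trans to ⇔-trans; sym to ⇔-sym)
open import Function.Properties.Inverse using (↔⇒↣)
open import Level using (0ℓ)
open import Relation.Binary using (tri<; tri≈; tri>)
open import Relation.Binary.PropositionalEquality
open import Relation.Nullary using (yes; no; contradiction)
open import Relation.Nullary.Decidable using (_×-dec_)
open import Relation.Unary using (Pred; Decidable)

open import Defs hiding (sym)

indicator : Bool → ℕ
indicator b = if b then 1 else 0

∧≡true⇔ : ∀ {a b} → a ∧ b ≡ true ⇔ (a ≡ true × b ≡ true)
∧≡true⇔ {a} {b} =
  mk⇔ (λ e → ∧-conicalˡ a b e , ∧-conicalʳ a b e) (λ (ea , eb) → cong₂ _∧_ ea eb)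

map-allFin-suc : ∀ {A : Set} {m} (f : Fin (suc m) → A) →
  map f (allFin (suc m)) ≡ f zero ∷ map (f ∘ suc) (allFin m)
map-allFin-suc f = cong (f zero ∷_) (trans (map-tabulate suc f) (sym (map-tabulate (λ i → i) (f ∘ suc))))

sum-map-allFin : ∀ {m} (f : Fin m → ℕ) → List.sum (map f (allFin m)) ≡ ∑[ i < m ] f i
sum-map-allFin {zero}  f = refl
sum-map-allFin {suc m} f = trans (cong List.sum (map-allFin-suc f)) (cong (f zero +_) (sum-map-allFin (f ∘ suc)))

∑-mono-≤ : ∀ {m} {f g : Fin m → ℕ} → (∀ i → f i ℕ.≤ g i) →
  ∑[ i < m ] f i ℕ.≤ ∑[ i < m ] g i
∑-mono-≤ {zero}  f≤g = z≤n
∑-mono-≤ {suc m} f≤g = +-mono-≤ (f≤g zero) (∑-mono-≤ (f≤g ∘ suc))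

∑-mono-< : ∀ {m} {f g : Fin m → ℕ} → (∀ i → f i ℕ.≤ g i) → ∀ j → f j ℕ.< g j →
  ∑[ i < m ] f i ℕ.< ∑[ i < m ] g i
∑-mono-< {suc m} f≤g zero    fj<gj = +-mono-<-≤ fj<gj (∑-mono-≤ (f≤g ∘ suc))
∑-mono-< {suc m} f≤g (suc j) fj<gj = +-mono-≤-< (f≤g zero) (∑-mono-< (f≤g ∘ suc) j fj<gj)

count : ∀ {m} → (Fin m → Bool) → ℕ
count {m} p = ∑[ x < m ] indicator (p x)

indicator-mono : ∀ {a b} → (a ≡ true → b ≡ true) → indicator a ℕ.≤ indicator b
indicator-mono {false} a⇒b = z≤n
indicator-mono {true}  a⇒b rewrite a⇒b refl = ≤-refl

indicator-∧-⇒ : ∀ {a b} → (a ≡ true → b ≡ true) → indicator (a ∧ b) ≡ indicator a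
indicator-∧-⇒ {false} a⇒b = refl
indicator-∧-⇒ {true}  a⇒b rewrite a⇒b refl = refl

_⊆ᵇ_ : ∀ {m} → (Fin m → Bool) → (Fin m → Bool) → Set
p ⊆ᵇ q = ∀ x → p x ≡ true → q x ≡ true

count-mono : ∀ {m} {p q : Fin m → Bool} → p ⊆ᵇ q → count p ℕ.≤ count q
count-mono p⊆q = ∑-mono-≤ (indicator-mono ∘ p⊆q)

count-∧-⊆ : ∀ {m} {p q : Fin m → Bool} → p ⊆ᵇ q → count (λ x → p x ∧ q x) ≡ count p
count-∧-⊆ p⊆q = sum-cong-≗ (indicator-∧-⇒ ∘ p⊆q)

count-∧-nested : ∀ {m} {p q : Fin m → Bool} → p ⊆ᵇ q ⊎ q ⊆ᵇ p →
  count (λ x → p x ∧ q x) ≡ count p ⊓ count q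
count-∧-nested (inj₁ p⊆q) = trans (count-∧-⊆ p⊆q) (sym (m≤n⇒m⊓n≡m (count-mono p⊆q)))
count-∧-nested {p = p} {q} (inj₂ q⊆p) = begin
  count (λ x → p x ∧ q x) ≡⟨ sum-cong-≗ (λ x → cong indicator (∧-comm (p x) (q x))) ⟩
  count (λ x → q x ∧ p x) ≡⟨ count-∧-⊆ q⊆p ⟩
  count q                 ≡⟨ sym (m≥n⇒m⊓n≡n (count-mono q⊆p)) ⟩
  count p ⊓ count q       ∎
  where open ≡-Reasoning

below : ∀ {m} → Fin m → Fin m → Bool
below v x = toℕ x <ᵇ toℕ v

below⇒< : ∀ {m} {v x : Fin m} → below v x ≡ true → x < v
below⇒< e = <ᵇ⇒< _ _ (Equivalence.from T-≡ e)

<⇒below : ∀ {m} {v x : Fin m} → x < v → below v x ≡ true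
<⇒below x<v = Equivalence.to T-≡ (<⇒<ᵇ x<v)

count-below : ∀ {m} (v : Fin m) → count (below v) ≡ toℕ v
count-below {suc m} zero    = sum-replicate-zero (suc m)
count-below {suc m} (suc v) = cong suc (count-below v)

lowerNeighbour : ∀ {m} → Graph m → Fin m → Fin m → Bool
lowerNeighbour G v x = adj G v x ∧ below v x

-- Threshold graphs have no alternating 4-cycle

NoAlternating4Cycle : ∀ {m} → (Fin m → Fin m → Bool) → Set
NoAlternating4Cycle E = ∀ a b c d → a ≢ d → c ≢ b →
  E a b ≡ true → E c d ≡ true → E a d ≡ false → E c b ≡ false → ⊥

noAlternating4Cycle-relabel : ∀ {m} {E E′ : Fin m → Fin m → Bool} (f : Fin m → Fin m) →
  (∀ {x y} → f x ≡ f y → x ≡ y) → (∀ x y → E′ x y ≡ E (f x) (f y)) →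
  NoAlternating4Cycle E → NoAlternating4Cycle E′
noAlternating4Cycle-relabel {E = E} {E′} f f-inj E′≡E noCycle a b c d a≢d c≢b ab cd ad cb =
  noCycle (f a) (f b) (f c) (f d) (a≢d ∘ f-inj) (c≢b ∘ f-inj)
    (via ab) (via cd) (via ad) (via cb)
  where
  via : ∀ {x y β} → E′ x y ≡ β → E (f x) (f y) ≡ β
  via {x} {y} e = trans (sym (E′≡E x y)) e

cycle₄-peak : ∀ {m} {P : Set} (a b c d : Fin m) →
  (b ≤ a → d ≤ a → P) → (a ≤ b → c ≤ b → P) →
  (d ≤ c → b ≤ c → P) → (c ≤ d → a ≤ d → P) → P
cycle₄-peak a b c d peak-a peak-b peak-c peak-d with ≤-total b a | ≤-total d c
... | inj₁ b≤a | inj₁ d≤c =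
  [ (λ c≤a → peak-a b≤a (≤-trans d≤c c≤a)) , (λ a≤c → peak-c d≤c (≤-trans b≤a a≤c)) ]′ (≤-total c a)
... | inj₁ b≤a | inj₂ c≤d = [ peak-a b≤a , peak-d c≤d ]′ (≤-total d a)
... | inj₂ a≤b | inj₁ d≤c = [ peak-b a≤b , peak-c d≤c ]′ (≤-total c b)
... | inj₂ a≤b | inj₂ c≤d =
  [ (λ d≤b → peak-b a≤b (≤-trans c≤d d≤b)) , (λ b≤d → peak-d c≤d (≤-trans a≤b b≤d)) ]′ (≤-total d b)

module _ {n} (bits : Vec Bool n) where

  constrAdj-below : ∀ {x y} → y < x → constrAdj bits x y ≡ bitOf bits x
  constrAdj-below {x} {y} y<x with toℕ x <ᵇ toℕ y in x<ᵇy | toℕ y <ᵇ toℕ x in y<ᵇx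
  ... | true  | _     = contradiction (<ᵇ⇒< _ _ (subst T (sym x<ᵇy) _)) (<⇒≯ y<x)
  ... | false | true  = refl
  ... | false | false = contradiction (subst T y<ᵇx (<⇒<ᵇ y<x)) (λ ())

  constrAdj-above : ∀ {x y} → x < y → constrAdj bits x y ≡ bitOf bits y
  constrAdj-above {x} {y} x<y with toℕ x <ᵇ toℕ y in x<ᵇy
  ... | true  = refl
  ... | false = contradiction (subst T x<ᵇy (<⇒<ᵇ x<y)) (λ ())

  constrAdj-irrefl : ∀ x → constrAdj bits x x ≡ false
  constrAdj-irrefl x with toℕ x <ᵇ toℕ x in x<ᵇx
  ... | true  = contradiction (<ᵇ⇒< _ _ (subst T (sym x<ᵇx) _)) (n≮n (toℕ x))
  ... | false = refl

  constrAdj-sym : ∀ x y → constrAdj bits x y ≡ constrAdj bits y x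
  constrAdj-sym x y with <-cmp x y
  ... | tri< x<y _ _  = trans (constrAdj-above x<y) (sym (constrAdj-below x<y))
  ... | tri≈ _ refl _ = refl
  ... | tri> _ _ y<x  = trans (constrAdj-below y<x) (sym (constrAdj-above y<x))

  constrAdj-noPeak : ∀ w u u′ → u ≤ w → u′ ≤ w → u′ ≢ w →
    constrAdj bits w u ≡ true → constrAdj bits w u′ ≡ false → ⊥
  constrAdj-noPeak w u u′ u≤w u′≤w u′≢w wu wu′ =
    contradiction (trans (sym bit-true) bit-false) (λ ())
    where
    u≢w : u ≢ w
    u≢w refl = contradiction (trans (sym wu) (constrAdj-irrefl w)) (λ ())
    bit-true : bitOf bits w ≡ true
    bit-true = trans (sym (constrAdj-below (≤∧≢⇒< u≤w u≢w))) wu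
    bit-false : bitOf bits w ≡ false
    bit-false = trans (sym (constrAdj-below (≤∧≢⇒< u′≤w u′≢w))) wu′

  constrAdj-noAlternating4Cycle : NoAlternating4Cycle (constrAdj bits)
  constrAdj-noAlternating4Cycle a b c d a≢d c≢b ab cd ad cb = cycle₄-peak a b c d
    (λ b≤a d≤a → constrAdj-noPeak a b d b≤a d≤a (a≢d ∘ sym) ab ad)
    (λ a≤b c≤b → constrAdj-noPeak b a c a≤b c≤b c≢b (flip a b ab) (flip c b cb))
    (λ d≤c b≤c → constrAdj-noPeak c d b d≤c b≤c (c≢b ∘ sym) cd cb)
    (λ c≤d a≤d → constrAdj-noPeak d c a c≤d a≤d a≢d (flip c d cd) (flip a d ad))
    where
    flip : ∀ x y {β} → constrAdj bits x y ≡ β → constrAdj bits y x ≡ β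
    flip x y e = trans (constrAdj-sym y x) e

threshold⇒noAlternating4Cycle : ∀ {n} (G : Graph (suc n)) → IsThreshold G → NoAlternating4Cycle (adj G)
threshold⇒noAlternating4Cycle G (bits , σ , adj≡constrAdj) =
  noAlternating4Cycle-relabel (σ ⟨$⟩ʳ_) (Injection.injective (↔⇒↣ σ)) adj≡constrAdj
    (constrAdj-noAlternating4Cycle bits)

-- Neighbourhoods in a threshold graph labelled by reverse degree sequence

edge⇒≢ : ∀ {m} (G : Graph m) {x y} → adj G x y ≡ true → y ≢ x
edge⇒≢ G {x} xy refl = contradiction (trans (sym xy) (irrefl G x)) (λ ())

deg≡count : ∀ {m} (G : Graph m) v → deg G v ≡ count (adj G v)
deg≡count G v = sum-map-allFin (indicator ∘ adj G v)

module _ {m} (G : Graph m) (noCycle : NoAlternating4Cycle (adj G)) where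

  -- The transposition of x and y matches the neighbours of x with neighbours of y, and v is unmatched.
  privateNeighbour⇒deg< : ∀ {v x y} → x ≢ v → y ≢ v → adj G v y ≡ true → adj G v x ≡ false →
    deg G x ℕ.< deg G y
  privateNeighbour⇒deg< {v} {x} {y} x≢v y≢v vy vx = begin-strict
    deg G x                                         ≡⟨ deg≡count G x ⟩
    ∑[ z < m ] indicator (adj G x z)                <⟨ ∑-mono-< (indicator-mono ∘ matched) v unmatched ⟩
    ∑[ z < m ] indicator (adj G y (τ ⟨$⟩ʳ z))       ≡⟨ ∑-permute (indicator ∘ adj G y) τ ⟨
    count (adj G y)                                 ≡⟨ deg≡count G y ⟨
    deg G y                                         ∎
    where
    open ≤-Reasoning
    τ : Permutation′ m
    τ = transpose x y
    matched : ∀ z → adj G x z ≡ true → adj G y (τ ⟨$⟩ʳ z) ≡ true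
    matched z xz with z ≟ x
    ... | yes refl = contradiction (trans (sym xz) (irrefl G x)) (λ ())
    ... | no z≢x with z ≟ y
    ...   | yes refl = trans (Graph.sym G y x) xz
    ...   | no z≢y with adj G y z in yz
    ...     | true  = refl
    ...     | false = ⊥-elim (noCycle v y z x (x≢v ∘ sym) z≢y vy
                        (trans (Graph.sym G z x) xz) vx (trans (Graph.sym G z y) yz))
    unmatched : indicator (adj G x v) ℕ.< indicator (adj G y (τ ⟨$⟩ʳ v))
    unmatched with v ≟ x
    ... | yes v≡x = contradiction (sym v≡x) x≢v
    ... | no _ with v ≟ y
    ...   | yes v≡y = contradiction (sym v≡y) y≢v
    ...   | no _ rewrite Graph.sym G x v | Graph.sym G y v | vx | vy = ℕ.s≤s z≤n

  module _ (rd : ReverseDegreeLabelled G) where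

    neighbours-downClosed : ∀ {v x y} → adj G v y ≡ true → x < y → x ≢ v → adj G v x ≡ true
    neighbours-downClosed {v} {x} {y} vy x<y x≢v with adj G v x in vx
    ... | true  = refl
    ... | false = contradiction (rd x y x<y) (<⇒≱ (privateNeighbour⇒deg< x≢v (edge⇒≢ G vy) vy vx))

    neighbours-nested : ∀ v → adj G v ⊆ᵇ below v ⊎ below v ⊆ᵇ adj G v
    neighbours-nested v with any? (λ x → (below v x Bool.≟ true) ×-dec (adj G v x Bool.≟ false))
    ... | yes (x₀ , x₀-below , vx₀) = inj₁ neighbours-below
      where
      neighbours-below : adj G v ⊆ᵇ below v
      neighbours-below y vy with below v y in y-below
      ... | true  = refl
      ... | false = contradiction (trans (sym (neighbours-downClosed vy x₀<y (<⇒≢ x₀<v))) vx₀) (λ ())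
        where
        v<y : v < y
        v<y = ≤∧≢⇒< (≮⇒≥ (λ y<v → contradiction (trans (sym (<⇒below y<v)) y-below) (λ ())))
                    (edge⇒≢ G vy ∘ sym)
        x₀<v : x₀ < v
        x₀<v = below⇒< x₀-below
        x₀<y : x₀ < y
        x₀<y = <-trans x₀<v v<y
    ... | no ∄x = inj₂ below-neighbours
      where
      below-neighbours : below v ⊆ᵇ adj G v
      below-neighbours x x<v with adj G v x in vx
      ... | true  = refl
      ... | false = contradiction (x , x<v , vx) ∄x

    count-lowerNeighbours : ∀ v → count (lowerNeighbour G v) ≡ dbar G v
    count-lowerNeighbours v = begin
      count (lowerNeighbour G v)          ≡⟨ count-∧-nested (neighbours-nested v) ⟩
      count (adj G v) ⊓ count (below v)   ≡⟨ cong₂ _⊓_ (sym (deg≡count G v)) (count-below v) ⟩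
      deg G v ⊓ toℕ v                     ∎
      where open ≡-Reasoning

-- Increasing spanning trees as choices of smaller parents

Decreasing : ∀ {n} → ParentMap n → Set
Decreasing p = ∀ i → lookup p i < suc i

module _ {n} {p : ParentMap n} (decreasing : Decreasing p) where

  anc-≤ : ∀ k v → toℕ (anc p k v) ℕ.≤ toℕ v ∸ k
  anc-≤ zero    v = ≤-refl
  anc-≤ (suc k) v = ℕₚ.≤-trans (anc-≤ k (parent p v))
    (subst (toℕ (parent p v) ∸ k ℕ.≤_) (∸-+-assoc (toℕ v) 1 k) (∸-monoˡ-≤ k (parent-≤ v)))
    where
    parent-≤ : ∀ v → toℕ (parent p v) ℕ.≤ toℕ v ∸ 1
    parent-≤ zero    = z≤n
    parent-≤ (suc i) = ℕ.s≤s⁻¹ (decreasing i)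

  decreasing⇒reachesRoot : ReachesRoot p
  decreasing⇒reachesRoot v =
    toℕ-injective (n≤0⇒n≡0 (ℕₚ.≤-trans (anc-≤ n v)
                                        (ℕₚ.≤-reflexive (m≤n⇒m∸n≡0 (toℕ≤pred[n] v)))))

  decreasing⇒increasing : Increasing p
  decreasing⇒increasing i j (_ , j<i , k , anc≡i) =
    <⇒≱ j<i (subst (λ u → toℕ u ℕ.≤ toℕ j) anc≡i
                    (ℕₚ.≤-trans (anc-≤ (toℕ k) j) (m∸n≤m (toℕ j) (toℕ k))))

-- A parent above its child would form an inversion with it.
increasing⇒decreasing : ∀ {n} {p : ParentMap n} → (∀ i → lookup p i ≢ suc i) →
  Increasing p → Decreasing p
increasing⇒decreasing {suc n} {p} noLoop increasing i with lookup p i <? suc i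
... | yes pᵢ<i = pᵢ<i
... | no pᵢ≮i  = ⊥-elim (increasing (lookup p i) (suc i) (pᵢ≢0 , i<pᵢ , suc zero , refl))
  where
  i<pᵢ : suc i < lookup p i
  i<pᵢ = ≤∧≢⇒< (≮⇒≥ pᵢ≮i) (noLoop i ∘ sym)
  pᵢ≢0 : lookup p i ≢ zero
  pᵢ≢0 pᵢ≡0 = contradiction (subst (suc i <_) pᵢ≡0 i<pᵢ) (λ ())

isIncreasingSpanningTree⇔ : ∀ {n} (G : Graph (suc n)) (p : ParentMap n) →
  IsIncreasingSpanningTree G p ⇔ (∀ i → lowerNeighbour G (suc i) (lookup p i) ≡ true)
isIncreasingSpanningTree⇔ G p = mk⇔
  (λ ((edges , _) , increasing) i → Equivalence.from ∧≡true⇔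
    (edges i , <⇒below (increasing⇒decreasing (edge⇒≢ G ∘ edges) increasing i)))
  (λ lower → let edges      = λ i → proj₁ (Equivalence.to ∧≡true⇔ (lower i))
                 decreasing = λ i → below⇒< (proj₂ (Equivalence.to ∧≡true⇔ (lower i)))
             in (edges , decreasing⇒reachesRoot decreasing) , decreasing⇒increasing decreasing)

allᵇ : ∀ {k m} → (Fin k → Fin m → Bool) → Vec (Fin m) k → Bool
allᵇ R []      = true
allᵇ R (x ∷ v) = R zero x ∧ allᵇ (R ∘ suc) v

allᵇ≡true⇔ : ∀ {k m} (R : Fin k → Fin m → Bool) v →
  allᵇ R v ≡ true ⇔ (∀ i → R i (lookup v i) ≡ true)
allᵇ≡true⇔ R []      = mk⇔ (λ _ ()) (λ _ → refl)
allᵇ≡true⇔ R (x ∷ v) = mk⇔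
  (λ e → let (head , tail) = Equivalence.to ∧≡true⇔ e in
         λ { zero → head ; (suc i) → Equivalence.to (allᵇ≡true⇔ (R ∘ suc) v) tail i })
  (λ h → Equivalence.from ∧≡true⇔
           (h zero , Equivalence.from (allᵇ≡true⇔ (R ∘ suc) v) (h ∘ suc)))

length-filter≡sum-indicator : ∀ {A : Set} {P : Pred A 0ℓ} (P? : Decidable P) (q : A → Bool) →
  (∀ x → P x ⇔ q x ≡ true) → ∀ xs → length (filter P? xs) ≡ List.sum (map (indicator ∘ q) xs)
length-filter≡sum-indicator P? q P⇔q [] = refl
length-filter≡sum-indicator P? q P⇔q (x ∷ xs) with P? x | q x in qx
... | yes Px  | true  = cong suc (length-filter≡sum-indicator P? q P⇔q xs)
... | yes Px  | false = contradiction (trans (sym qx) (Equivalence.to (P⇔q x) Px)) (λ ())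
... | no ¬Px | true  = contradiction (Equivalence.from (P⇔q x) qx) ¬Px
... | no ¬Px | false = length-filter≡sum-indicator P? q P⇔q xs

sum-map-concatMap : ∀ {A B : Set} (g : B → ℕ) (f : A → List B) xs →
  List.sum (map g (concatMap f xs)) ≡ List.sum (map (List.sum ∘ map g ∘ f) xs)
sum-map-concatMap g f []       = refl
sum-map-concatMap g f (x ∷ xs) = begin
  List.sum (map g (f x ++ concatMap f xs))                   ≡⟨ cong List.sum (map-++ g (f x) _) ⟩
  List.sum (map g (f x) ++ map g (concatMap f xs))           ≡⟨ sum-++ (map g (f x)) _ ⟩
  List.sum (map g (f x)) + List.sum (map g (concatMap f xs)) ≡⟨ cong (_ +_) (sum-map-concatMap g f xs) ⟩
  List.sum (map (List.sum ∘ map g ∘ f) (x ∷ xs))             ∎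
  where open ≡-Reasoning

sum-map-indicator-∧ : ∀ {A : Set} b (q : A → Bool) xs →
  List.sum (map (λ x → indicator (b ∧ q x)) xs) ≡ indicator b * List.sum (map (indicator ∘ q) xs)
sum-map-indicator-∧ true  q xs       = sym (*-identityˡ _)
sum-map-indicator-∧ false q []       = refl
sum-map-indicator-∧ false q (_ ∷ xs) = sum-map-indicator-∧ false q xs

sum-indicator-allᵇ : ∀ {m} k (R : Fin k → Fin m → Bool) →
  List.sum (map (indicator ∘ allᵇ R) (allVecs k)) ≡ product (map (count ∘ R) (allFin k))
sum-indicator-allᵇ         zero    R = refl
sum-indicator-allᵇ {m} (suc k) R = begin
  List.sum (map (indicator ∘ allᵇ R) (concatMap (λ x → map (x ∷_) (allVecs k)) (allFin m)))
    ≡⟨ sum-map-concatMap (indicator ∘ allᵇ R) (λ x → map (x ∷_) (allVecs k)) (allFin m) ⟩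
  List.sum (map (λ x → List.sum (map (indicator ∘ allᵇ R) (map (x ∷_) (allVecs k)))) (allFin m))
    ≡⟨ cong List.sum (map-cong first-coordinate (allFin m)) ⟩
  List.sum (map (λ x → indicator (R zero x) * N) (allFin m))
    ≡⟨ sum-map-allFin (λ x → indicator (R zero x) * N) ⟩
  ∑[ x < m ] (indicator (R zero x) * N)
    ≡⟨ *-distribʳ-sum N (indicator ∘ R zero) ⟨
  count (R zero) * N
    ≡⟨ cong (count (R zero) *_) (sum-indicator-allᵇ k (R ∘ suc)) ⟩
  count (R zero) * product (map (count ∘ R ∘ suc) (allFin k))
    ≡⟨ cong product (map-allFin-suc (count ∘ R)) ⟨
  product (map (count ∘ R) (allFin (suc k)))
    ∎
  where
  open ≡-Reasoning
  N : ℕ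
  N = List.sum (map (indicator ∘ allᵇ (R ∘ suc)) (allVecs k))
  first-coordinate : ∀ x →
    List.sum (map (indicator ∘ allᵇ R) (map (x ∷_) (allVecs k))) ≡ indicator (R zero x) * N
  first-coordinate x = trans (cong List.sum (sym (map-∘ (allVecs k))))
    (sum-map-indicator-∧ (R zero x) (allᵇ (R ∘ suc)) (allVecs k))

proposition4p1 : (n : ℕ) (G : Graph (suc n)) → IsThreshold G → ReverseDegreeLabelled G →
    numIncreasingSpanningTrees G ≡ product (map (λ (i : Data.Fin.Fin n) → dbar G (suc i)) (allFin n))
proposition4p1 n G threshold labelled = begin
  numIncreasingSpanningTrees G
    ≡⟨ length-filter≡sum-indicator (isIncreasingSpanningTree? G) (allᵇ lowerParent)
         (λ p → ⇔-trans (isIncreasingSpanningTree⇔ G p) (⇔-sym (allᵇ≡true⇔ lowerParent p))) (allVecs n) ⟩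
  List.sum (map (indicator ∘ allᵇ lowerParent) (allVecs n))
    ≡⟨ sum-indicator-allᵇ n lowerParent ⟩
  product (map (count ∘ lowerParent) (allFin n))
    ≡⟨ cong product (map-cong (count-lowerNeighbours G noCycle labelled ∘ suc) (allFin n)) ⟩
  product (map (λ i → dbar G (suc i)) (allFin n))
    ∎
  where
  open ≡-Reasoning
  lowerParent : Fin n → Fin (suc n) → Bool
  lowerParent i = lowerNeighbour G (suc i)
  noCycle : NoAlternating4Cycle (adj G)
  noCycle = threshold⇒noAlternating4Cycle G threshold
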